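{- No set in $\mathrm{RE}-\mathrm{REC}$ is $\mathrm{F_{REC}}$-compressible. In particular, no $\mathrm{RE}$-complete set is $\mathrm{F_{REC}}$-compressible.
   Context: $\Sigma=\{0,1\}$. $\mathrm{RE}$ and $\mathrm{REC}$ are the recursively enumerable and recursive subsets of $\Sigma^\ast$; a set is $\mathrm{RE}$-complete if it is in $\mathrm{RE}$ and every set in $\mathrm{RE}$ many-one reduces to it via a total recursive function. $\mathrm{F_{REC}}$ is the class of total recursive functions $\Sigma^\ast\to\Sigma^\ast$. A function $f$ is a compression function for $A$ if $f$ is defined on all of $A$, $f(A)=\Sigma^\ast$, and $f$ is injective on $A$ (no condition outside $A$); $A$ is $\mathrm{F_{REC}}$-compressible if it has a compression function in $\mathrm{F_{REC}}$. -}

module Defs where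

open import Data.Nat using (ℕ; zero; suc; _+_; _*_; _<_)
open import Data.Fin using (Fin)
open import Data.Vec using (Vec; []; _∷_; lookup)
open import Data.List using (List; []; _∷_)
open import Data.Bool using (Bool; true; false)
open import Data.Product using (Σ; ∃; _×_; _,_)
open import Relation.Nullary using (¬_)
open import Relation.Binary.PropositionalEquality using (_≡_)
open import Function.Bundles using (_⇔_)

-- Σ = {0,1}, Σ* = lists of bits (false = 0, true = 1).

Word : Set
Word = List Bool

Language : Set₁
Language = Word → Set

-- Standard bijection Σ* → ℕ (bijective base-2 numeration):
-- ε ↦ 0,  0w ↦ 2·enc(w)+1,  1w ↦ 2·enc(w)+2.
enc : Word → ℕ
enc []          = 0
enc (false ∷ w) = suc (2 * enc w)
enc (true  ∷ w) = suc (suc (2 * enc w))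

data Code : ℕ → Set where
  zer  : ∀ {n} → Code n
  succ : Code 1
  proj : ∀ {n} → Fin n → Code n
  comp : ∀ {n m} → Code m → Vec (Code n) m → Code n
  prec : ∀ {n} → Code n → Code (suc (suc n)) → Code (suc n)
  mu   : ∀ {n} → Code (suc n) → Code n

mutual
  data Eval : ∀ {n} → Code n → Vec ℕ n → ℕ → Set where
    ev-zer  : ∀ {n} {xs : Vec ℕ n} → Eval zer xs 0
    ev-succ : ∀ {x} → Eval succ (x ∷ []) (suc x)
    ev-proj : ∀ {n} {i : Fin n} {xs} → Eval (proj i) xs (lookup xs i)
    ev-comp : ∀ {n m} {f : Code m} {gs : Vec (Code n) m} {xs ys y} →
              EvalAll gs xs ys → Eval f ys y → Eval (comp f gs) xs y
    ev-prec-z : ∀ {n} {f : Code n} {g} {xs y} →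
                Eval f xs y → Eval (prec f g) (0 ∷ xs) y
    ev-prec-s : ∀ {n} {f : Code n} {g} {k xs r y} →
                Eval (prec f g) (k ∷ xs) r → Eval g (k ∷ r ∷ xs) y →
                Eval (prec f g) (suc k ∷ xs) y
    ev-mu   : ∀ {n} {f : Code (suc n)} {xs y} →
              Eval f (y ∷ xs) 0 →
              (∀ z → z < y → ∃ λ v → Eval f (z ∷ xs) (suc v)) →
              Eval (mu f) xs y

  data EvalAll {n} : ∀ {m} → Vec (Code n) m → Vec ℕ n → Vec ℕ m → Set where
    []  : ∀ {xs} → EvalAll [] xs []
    _∷_ : ∀ {m} {g : Code n} {gs : Vec (Code n) m} {xs y ys} →
          Eval g xs y → EvalAll gs xs ys → EvalAll (g ∷ gs) xs (y ∷ ys)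

IsTotalRecursive : (Word → Word) → Set
IsTotalRecursive f = Σ (Code 1) λ c → ∀ w → Eval c (enc w ∷ []) (enc (f w))

IsREC : Language → Set
IsREC A = Σ (Code 1) λ c → ∀ w →
  (A w → Eval c (enc w ∷ []) 1) × (¬ A w → Eval c (enc w ∷ []) 0)

IsRE : Language → Set
IsRE A = Σ (Code 1) λ c → ∀ w → A w ⇔ (∃ λ y → Eval c (enc w ∷ []) y)

_≤m_ : Language → Language → Set
B ≤m A = Σ (Word → Word) λ f → IsTotalRecursive f × (∀ w → B w ⇔ A (f w))

IsRE-complete : Language → Set₁
IsRE-complete A = IsRE A × (∀ B → IsRE B → B ≤m A)

IsCompressionFunction : Language → (Word → Word) → Set
IsCompressionFunction A f =
  (∀ y → ∃ λ x → A x × f x ≡ y) ×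
  (∀ x x′ → A x → A x′ → f x ≡ f x′ → x ≡ x′)

IsFREC-compressible : Language → Set
IsFREC-compressible A =
  Σ (Word → Word) λ f → IsTotalRecursive f × IsCompressionFunction A f

module Submission where

-- Let A be r.e. and f a total recursive compression function for A. To decide w ∈ A, search
-- for some x ∈ A (certified by a halting computation of A's semi-decider) with f x = f w;
-- one exists because f(A) = Σ*, and as f is injective on A, w ∈ A iff the x found is w.
-- Hence A is recursive. An RE-complete set is not recursive, since the diagonal halting
-- set K reduces to it. The searches use Kleene's normal form: a number encodes a node of a
-- computation tree (code, arguments, output, children), and the validity of such trees is
-- primitive recursive by course-of-values recursion, children having smaller codes.

open import Defs
open import Data.Nat using (ℕ; zero; suc; _+_; _*_; _∸_; _<_; _≤_; z≤n; s≤s; pred; ∣_-_∣; _≤?_; _<?_; ≢-nonZero)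
open import Data.Nat.Properties
open import Data.Nat.Induction using (<-rec)
open import Data.Fin using (Fin; toℕ; fromℕ<) renaming (zero to fzero; suc to fsuc)
open import Data.Fin.Properties using (toℕ-fromℕ<; toℕ<n)
open import Data.Vec using (Vec; []; _∷_; lookup; tabulate; map)
open import Data.Vec.Properties using (lookup∘tabulate)
open import Data.Vec.Relation.Unary.All using (All; []; _∷_)
open import Data.List using ([]; _∷_)
open import Data.Bool using (true; false)
open import Data.Product using (Σ; _×_; _,_; proj₁; proj₂)
open import Data.Empty using (⊥-elim)
open import Data.Sum using (_⊎_; inj₁; inj₂)
open import Relation.Nullary using (¬_; yes; no)
open import Relation.Binary.PropositionalEquality
open import Relation.Binary.Definitions using (tri<; tri≈; tri>)
open import Function.Bundles using (Equivalence; mk⇔)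

mutual
  Eval-deterministic : ∀ {n} {c : Code n} {xs a b} → Eval c xs a → Eval c xs b → a ≡ b
  Eval-deterministic ev-zer ev-zer = refl
  Eval-deterministic ev-succ ev-succ = refl
  Eval-deterministic ev-proj ev-proj = refl
  Eval-deterministic (ev-comp gs f) (ev-comp gs′ f′)
    rewrite EvalAll-deterministic gs gs′ = Eval-deterministic f f′
  Eval-deterministic (ev-prec-z f) (ev-prec-z f′) = Eval-deterministic f f′
  Eval-deterministic (ev-prec-s r g) (ev-prec-s r′ g′)
    rewrite Eval-deterministic r r′ = Eval-deterministic g g′
  Eval-deterministic (ev-mu {y = y} zero-at-y below-y) (ev-mu {y = y′} zero-at-y′ below-y′)
    with <-cmp y y′
  ... | tri≈ _ y≡y′ _ = y≡y′
  ... | tri< y<y′ _ _ with below-y′ y y<y′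
  ...   | _ , positive = ⊥-elim (0≢1+n (Eval-deterministic zero-at-y positive))
  Eval-deterministic (ev-mu zero-at-y below-y) (ev-mu zero-at-y′ below-y′)
      | tri> _ _ y′<y with below-y _ y′<y
  ...   | _ , positive = ⊥-elim (0≢1+n (Eval-deterministic zero-at-y′ positive))

  EvalAll-deterministic : ∀ {n m} {gs : Vec (Code n) m} {xs ys zs} →
                          EvalAll gs xs ys → EvalAll gs xs zs → ys ≡ zs
  EvalAll-deterministic [] [] = refl
  EvalAll-deterministic (p ∷ ps) (q ∷ qs) =
    cong₂ _∷_ (Eval-deterministic p q) (EvalAll-deterministic ps qs)

-- Total computable functions

Fn : ℕ → Set
Fn n = Vec ℕ n → ℕ

Computable : ∀ n → Fn n → Set
Computable n f = Σ (Code n) λ c → ∀ xs → Eval c xs (f xs)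

Computable-resp : ∀ {n} {f g : Fn n} → (∀ xs → f xs ≡ g xs) → Computable n f → Computable n g
Computable-resp f≡g (c , ev) = c , λ xs → subst (Eval c xs) (f≡g xs) (ev xs)

codesOf : ∀ {n m} {gs : Vec (Fn n) m} → All (Computable n) gs → Vec (Code n) m
codesOf [] = []
codesOf (g ∷ gs) = proj₁ g ∷ codesOf gs

evalAll-codesOf : ∀ {n m} {gs : Vec (Fn n) m} (cgs : All (Computable n) gs) xs →
                  EvalAll (codesOf cgs) xs (map (λ g → g xs) gs)
evalAll-codesOf [] xs = []
evalAll-codesOf (g ∷ gs) xs = proj₂ g xs ∷ evalAll-codesOf gs xs

compose : ∀ {n m} {f : Fn m} {gs : Vec (Fn n) m} →
          Computable m f → All (Computable n) gs → Computable n (λ xs → f (map (λ g → g xs) gs))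
compose (c , ev) cgs = comp c (codesOf cgs) , λ xs → ev-comp (evalAll-codesOf cgs xs) (ev _)

unary : (ℕ → ℕ) → Fn 1
unary f (x ∷ []) = f x

binary : (ℕ → ℕ → ℕ) → Fn 2
binary f (x ∷ y ∷ []) = f x y

ternary : (ℕ → ℕ → ℕ → ℕ) → Fn 3
ternary f (x ∷ y ∷ z ∷ []) = f x y z

comp₁ : ∀ {n} {f : Fn 1} {g : Fn n} → Computable 1 f → Computable n g →
        Computable n (λ xs → f (g xs ∷ []))
comp₁ F G = compose F (G ∷ [])

comp₂ : ∀ {n} {f : Fn 2} {g h : Fn n} → Computable 2 f →
        Computable n g → Computable n h → Computable n (λ xs → f (g xs ∷ h xs ∷ []))
comp₂ F G H = compose F (G ∷ H ∷ [])

comp₃ : ∀ {n} {f : Fn 3} {g h k : Fn n} → Computable 3 f →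
        Computable n g → Computable n h → Computable n k →
        Computable n (λ xs → f (g xs ∷ h xs ∷ k xs ∷ []))
comp₃ F G H K = compose F (G ∷ H ∷ K ∷ [])

arg₀ : ∀ {n} → Fn (suc n)
arg₀ (x ∷ _) = x

arg₁ : ∀ {n} → Fn (suc (suc n))
arg₁ (_ ∷ x ∷ _) = x

arg₂ : ∀ {n} → Fn (suc (suc (suc n)))
arg₂ (_ ∷ _ ∷ x ∷ _) = x

arg₃ : ∀ {n} → Fn (suc (suc (suc (suc n))))
arg₃ (_ ∷ _ ∷ _ ∷ x ∷ _) = x

projᶜ : ∀ {n} (i : Fin n) → Computable n (λ xs → lookup xs i)
projᶜ i = proj i , λ _ → ev-proj

π₀ : ∀ {n} → Computable (suc n) arg₀
π₀ = Computable-resp (λ { (_ ∷ _) → refl }) (projᶜ fzero)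

π₁ : ∀ {n} → Computable (suc (suc n)) arg₁
π₁ = Computable-resp (λ { (_ ∷ _ ∷ _) → refl }) (projᶜ (fsuc fzero))

π₂ : ∀ {n} → Computable (suc (suc (suc n))) arg₂
π₂ = Computable-resp (λ { (_ ∷ _ ∷ _ ∷ _) → refl }) (projᶜ (fsuc (fsuc fzero)))

π₃ : ∀ {n} → Computable (suc (suc (suc (suc n)))) arg₃
π₃ = Computable-resp (λ { (_ ∷ _ ∷ _ ∷ _ ∷ _) → refl }) (projᶜ (fsuc (fsuc (fsuc fzero))))

zeroᶜ : ∀ {n} → Computable n (λ _ → 0)
zeroᶜ = zer , λ _ → ev-zer

sucᶜ : Computable 1 (unary suc)
sucᶜ = succ , λ { (_ ∷ []) → ev-succ }

constᶜ : ∀ {n} k → Computable n (λ _ → k)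
constᶜ zero = zeroᶜ
constᶜ (suc k) = comp₁ sucᶜ (constᶜ k)

uncurryHead : ∀ {n} → (ℕ → Vec ℕ n → ℕ) → Fn (suc n)
uncurryHead R (k ∷ xs) = R k xs

primrec : ∀ {n} {f : Fn n} {g : Fn (suc (suc n))} (R : ℕ → Vec ℕ n → ℕ) →
          Computable n f → Computable (suc (suc n)) g →
          (∀ xs → f xs ≡ R 0 xs) → (∀ k xs → g (k ∷ R k xs ∷ xs) ≡ R (suc k) xs) →
          Computable (suc n) (uncurryHead R)
primrec {f = f} {g} R (cf , evf) (cg , evg) base step =
  prec cf cg , λ { (k ∷ xs) → eval k xs }
  where
  eval : ∀ k xs → Eval (prec cf cg) (k ∷ xs) (R k xs)
  eval zero xs = ev-prec-z (subst (Eval cf xs) (base xs) (evf xs))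
  eval (suc k) xs = ev-prec-s (eval k xs) (subst (Eval cg _) (step k xs) (evg _))

withoutParams : (ℕ → ℕ) → ℕ → Vec ℕ 0 → ℕ
withoutParams f k [] = f k

withParam : (ℕ → ℕ → ℕ) → ℕ → Vec ℕ 1 → ℕ
withParam f k (y ∷ []) = f k y

primrec₁ : (h : ℕ → ℕ) {g : Fn 2} → Computable 2 g →
           (∀ k → g (k ∷ h k ∷ []) ≡ h (suc k)) → Computable 1 (unary h)
primrec₁ h G step =
  Computable-resp (λ { (_ ∷ []) → refl })
    (primrec (withoutParams h) (constᶜ (h 0)) G (λ { [] → refl }) (λ { k [] → step k }))

primrec₂ : (h : ℕ → ℕ → ℕ) {f : Fn 1} {g : Fn 3} → Computable 1 f → Computable 3 g →
           (∀ y → f (y ∷ []) ≡ h 0 y) → (∀ k y → g (k ∷ h k y ∷ y ∷ []) ≡ h (suc k) y) →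
           Computable 2 (binary h)
primrec₂ h F G base step =
  Computable-resp (λ { (_ ∷ _ ∷ []) → refl })
    (primrec (withParam h) F G (λ { (y ∷ []) → base y }) (λ { k (y ∷ []) → step k y }))

addᶜ : Computable 2 (binary _+_)
addᶜ = primrec₂ _+_ π₀ (comp₁ sucᶜ π₁) (λ _ → refl) (λ _ _ → refl)

mulᶜ : Computable 2 (binary _*_)
mulᶜ = primrec₂ _*_ zeroᶜ (comp₂ addᶜ π₂ π₁) (λ _ → refl) (λ _ _ → refl)

predᶜ : Computable 1 (unary pred)
predᶜ = primrec₁ pred π₀ (λ _ → refl)

monusᶜ : Computable 2 (binary _∸_)
monusᶜ = Computable-resp (λ { (_ ∷ _ ∷ []) → refl }) (comp₂ flipped π₁ π₀)
  where
  flipped : Computable 2 (binary λ n m → m ∸ n)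
  flipped = primrec₂ (λ n m → m ∸ n) π₀ (comp₁ predᶜ π₁) (λ _ → refl) (λ k m → pred[m∸n]≡m∸[1+n] m k)

isZero : ℕ → ℕ
isZero zero = 1
isZero (suc _) = 0

isZeroᶜ : Computable 1 (unary isZero)
isZeroᶜ = primrec₁ isZero zeroᶜ (λ _ → refl)

isZero≡1⇒≡0 : ∀ {n} → isZero n ≡ 1 → n ≡ 0
isZero≡1⇒≡0 {zero} _ = refl

isZero≡0⇒≡suc : ∀ {n} → isZero n ≡ 0 → n ≡ suc (pred n)
isZero≡0⇒≡suc {suc _} _ = refl

sg : ℕ → ℕ
sg zero = 0
sg (suc _) = 1

sgᶜ : Computable 1 (unary sg)
sgᶜ = primrec₁ sg (constᶜ 1) (λ _ → refl)

∣m-n∣≡m∸n+n∸m : ∀ m n → ∣ m - n ∣ ≡ (m ∸ n) + (n ∸ m)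
∣m-n∣≡m∸n+n∸m zero zero = refl
∣m-n∣≡m∸n+n∸m zero (suc n) = refl
∣m-n∣≡m∸n+n∸m (suc m) zero = sym (+-identityʳ (suc m))
∣m-n∣≡m∸n+n∸m (suc m) (suc n) = ∣m-n∣≡m∸n+n∸m m n

distᶜ : Computable 2 (binary ∣_-_∣)
distᶜ = Computable-resp (λ { (m ∷ n ∷ []) → sym (∣m-n∣≡m∸n+n∸m m n) })
          (comp₂ addᶜ (comp₂ monusᶜ π₀ π₁) (comp₂ monusᶜ π₁ π₀))

eqᵇ : ℕ → ℕ → ℕ
eqᵇ m n = isZero ∣ m - n ∣

eqᵇᶜ : Computable 2 (binary eqᵇ)
eqᵇᶜ = Computable-resp (λ { (_ ∷ _ ∷ []) → refl }) (comp₁ isZeroᶜ distᶜ)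

eqᵇ-refl : ∀ n → eqᵇ n n ≡ 1
eqᵇ-refl n = cong isZero (∣n-n∣≡0 n)

≡⇒eqᵇ≡1 : ∀ {m n} → m ≡ n → eqᵇ m n ≡ 1
≡⇒eqᵇ≡1 {m} refl = eqᵇ-refl m

eqᵇ≡1⇒≡ : ∀ {m n} → eqᵇ m n ≡ 1 → m ≡ n
eqᵇ≡1⇒≡ {m} {n} eq with ∣ m - n ∣ in dist
... | zero = ∣m-n∣≡0⇒m≡n dist

≢⇒eqᵇ≡0 : ∀ {m n} → m ≢ n → eqᵇ m n ≡ 0
≢⇒eqᵇ≡0 {m} {n} m≢n with ∣ m - n ∣ in dist
... | zero = ⊥-elim (m≢n (∣m-n∣≡0⇒m≡n dist))
... | suc _ = refl

leqᵇ : ℕ → ℕ → ℕ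
leqᵇ m n = isZero (m ∸ n)

leqᵇᶜ : Computable 2 (binary leqᵇ)
leqᵇᶜ = Computable-resp (λ { (_ ∷ _ ∷ []) → refl }) (comp₁ isZeroᶜ monusᶜ)

≤⇒leqᵇ≡1 : ∀ {m n} → m ≤ n → leqᵇ m n ≡ 1
≤⇒leqᵇ≡1 m≤n = cong isZero (m≤n⇒m∸n≡0 m≤n)

≰⇒leqᵇ≡0 : ∀ {m n} → ¬ m ≤ n → leqᵇ m n ≡ 0
≰⇒leqᵇ≡0 {m} {n} m≰n with m ∸ n in diff
... | zero = ⊥-elim (m≰n (m∸n≡0⇒m≤n diff))
... | suc _ = refl

opaque
  ifPos : ℕ → ℕ → ℕ → ℕ
  ifPos c a b = sg c * a + isZero c * b

  ifPosᶜ : Computable 3 (ternary ifPos)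
  ifPosᶜ = Computable-resp (λ { (_ ∷ _ ∷ _ ∷ []) → refl })
    (comp₂ addᶜ (comp₂ mulᶜ (comp₁ sgᶜ π₀) π₁) (comp₂ mulᶜ (comp₁ isZeroᶜ π₀) π₂))

  ifPos-suc : ∀ c a b → ifPos (suc c) a b ≡ a
  ifPos-suc c a b = trans (+-identityʳ (a + 0)) (+-identityʳ a)

  ifPos-zero : ∀ a b → ifPos 0 a b ≡ b
  ifPos-zero a b = +-identityʳ b

allOne : ∀ {m} → Vec ℕ m → ℕ
allOne [] = 1
allOne (a ∷ as) = a * allOne as

allOneᶜ : ∀ {n m} {gs : Vec (Fn n) m} → All (Computable n) gs →
          Computable n (λ xs → allOne (map (λ g → g xs) gs))
allOneᶜ [] = constᶜ 1
allOneᶜ (G ∷ Gs) = comp₂ mulᶜ G (allOneᶜ Gs)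

allOne≡1⇒All : ∀ {m} (as : Vec ℕ m) → allOne as ≡ 1 → All (_≡ 1) as
allOne≡1⇒All [] _ = []
allOne≡1⇒All (a ∷ as) eq =
  m*n≡1⇒m≡1 a (allOne as) eq ∷ allOne≡1⇒All as (m*n≡1⇒n≡1 a (allOne as) eq)

All⇒allOne≡1 : ∀ {m} (as : Vec ℕ m) → All (_≡ 1) as → allOne as ≡ 1
All⇒allOne≡1 [] [] = refl
All⇒allOne≡1 (_ ∷ as) (refl ∷ ones) = trans (+-identityʳ (allOne as)) (All⇒allOne≡1 as ones)

prod< : (ℕ → ℕ) → ℕ → ℕ
prod< f zero = 1
prod< f (suc m) = prod< f m * f m

prod<ᶜ : ∀ {h : Fn 3} → Computable 3 h →
  Computable 3 (λ { (m ∷ a ∷ b ∷ []) → prod< (λ i → h (i ∷ a ∷ b ∷ [])) m })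
prod<ᶜ {h} H =
  Computable-resp (λ { (_ ∷ _ ∷ _ ∷ []) → refl })
    (primrec (λ { m (a ∷ b ∷ []) → prod< (λ i → h (i ∷ a ∷ b ∷ [])) m }) (constᶜ 1)
       (comp₂ mulᶜ π₁ (comp₃ H π₀ π₂ π₃)) (λ { (_ ∷ _ ∷ []) → refl }) (λ { k (_ ∷ _ ∷ []) → refl }))

prod<≡1⇒ : ∀ f m → prod< f m ≡ 1 → ∀ i → i < m → f i ≡ 1
prod<≡1⇒ f (suc m) eq i i<1+m with m≤n⇒m<n∨m≡n (≤-pred i<1+m)
... | inj₁ i<m = prod<≡1⇒ f m (m*n≡1⇒m≡1 (prod< f m) (f m) eq) i i<m
... | inj₂ refl = m*n≡1⇒n≡1 (prod< f m) (f m) eq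

⇒prod<≡1 : ∀ f m → (∀ i → i < m → f i ≡ 1) → prod< f m ≡ 1
⇒prod<≡1 f zero _ = refl
⇒prod<≡1 f (suc m) ones
  rewrite ⇒prod<≡1 f m (λ i i<m → ones i (m<n⇒m<1+n i<m)) | ones m ≤-refl = refl

-- Pairing and sequence codes

tri : ℕ → ℕ
tri zero = 0
tri (suc k) = suc k + tri k

triᶜ : Computable 1 (unary tri)
triᶜ = primrec₁ tri (comp₂ addᶜ (comp₁ sucᶜ π₀) π₁) (λ _ → refl)

tri-mono-≤ : ∀ {a b} → a ≤ b → tri a ≤ tri b
tri-mono-≤ {zero} _ = z≤n
tri-mono-≤ {suc a} {suc b} (s≤s a≤b) = +-mono-≤ (s≤s a≤b) (tri-mono-≤ a≤b)

n≤tri : ∀ n → n ≤ tri n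
n≤tri zero = z≤n
n≤tri (suc n) = m≤m+n (suc n) (tri n)

IsTriRoot : ℕ → ℕ → Set
IsTriRoot r n = tri r ≤ n × n < tri (suc r)

IsTriRoot-unique : ∀ {r r′ n} → IsTriRoot r n → IsTriRoot r′ n → r ≡ r′
IsTriRoot-unique {r} {r′} (lo , hi) (lo′ , hi′) with <-cmp r r′
... | tri≈ _ r≡r′ _ = r≡r′
... | tri< r<r′ _ _ = ⊥-elim (<⇒≱ hi (≤-trans (tri-mono-≤ r<r′) lo′))
... | tri> _ _ r′<r = ⊥-elim (<⇒≱ hi′ (≤-trans (tri-mono-≤ r′<r) lo))

triRootStep : ℕ → ℕ → ℕ
triRootStep n r = ifPos (leqᵇ (tri (suc r)) (suc n)) (suc r) r

triRoot : ℕ → ℕ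
triRoot zero = 0
triRoot (suc n) = triRootStep n (triRoot n)

triRootᶜ : Computable 1 (unary triRoot)
triRootᶜ = primrec₁ triRoot
  (comp₃ ifPosᶜ (comp₂ leqᵇᶜ (comp₁ triᶜ (comp₁ sucᶜ π₁)) (comp₁ sucᶜ π₀)) (comp₁ sucᶜ π₁) π₁)
  (λ _ → refl)

triRoot-spec : ∀ n → IsTriRoot (triRoot n) n
triRoot-spec zero = z≤n , s≤s z≤n
triRoot-spec (suc n) with triRoot n | triRoot-spec n
... | r | lo , hi with tri (suc r) ≤? suc n
...   | yes next≤ rewrite ≤⇒leqᵇ≡1 next≤ | ifPos-suc 0 (suc r) r =
          next≤ , s≤s (subst (_≤ suc r + tri (suc r)) (≤-antisym next≤ hi) (m≤n+m (tri (suc r)) (suc r)))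
...   | no next≰ rewrite ≰⇒leqᵇ≡0 next≰ | ifPos-zero (suc r) r = m≤n⇒m≤1+n lo , ≰⇒> next≰

opaque
  pair : ℕ → ℕ → ℕ
  pair a b = tri (a + b) + b

  unpair₂ : ℕ → ℕ
  unpair₂ n = n ∸ tri (triRoot n)

  unpair₁ : ℕ → ℕ
  unpair₁ n = triRoot n ∸ unpair₂ n

  pairᶜ : Computable 2 (binary pair)
  pairᶜ = Computable-resp (λ { (_ ∷ _ ∷ []) → refl })
            (comp₂ addᶜ (comp₁ triᶜ (comp₂ addᶜ π₀ π₁)) π₁)

  unpair₂ᶜ : Computable 1 (unary unpair₂)
  unpair₂ᶜ = Computable-resp (λ { (_ ∷ []) → refl })
               (comp₂ monusᶜ π₀ (comp₁ triᶜ (comp₁ triRootᶜ π₀)))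

  unpair₁ᶜ : Computable 1 (unary unpair₁)
  unpair₁ᶜ = Computable-resp (λ { (_ ∷ []) → refl })
               (comp₂ monusᶜ (comp₁ triRootᶜ π₀) (comp₁ unpair₂ᶜ π₀))

  triRoot-pair : ∀ a b → triRoot (pair a b) ≡ a + b
  triRoot-pair a b = IsTriRoot-unique (triRoot-spec (pair a b)) (lo , hi)
    where
    lo : tri (a + b) ≤ pair a b
    lo = m≤m+n (tri (a + b)) b
    hi : pair a b < tri (suc (a + b))
    hi = subst (tri (a + b) + b <_) (+-comm (tri (a + b)) (suc (a + b)))
           (+-monoʳ-< (tri (a + b)) (s≤s (m≤n+m b a)))

  unpair₂-pair : ∀ a b → unpair₂ (pair a b) ≡ b
  unpair₂-pair a b rewrite triRoot-pair a b = m+n∸m≡n (tri (a + b)) b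

  unpair₁-pair : ∀ a b → unpair₁ (pair a b) ≡ a
  unpair₁-pair a b rewrite unpair₂-pair a b | triRoot-pair a b = m+n∸n≡m a b

  unpair₂-≤ : ∀ n → unpair₂ n ≤ n
  unpair₂-≤ n = m∸n≤m n (tri (triRoot n))

  unpair₁-≤ : ∀ n → unpair₁ n ≤ n
  unpair₁-≤ n = ≤-trans (m∸n≤m (triRoot n) (unpair₂ n))
                  (≤-trans (n≤tri (triRoot n)) (proj₁ (triRoot-spec n)))

  unpair₁-zero : unpair₁ 0 ≡ 0
  unpair₁-zero = refl

  pair-suc-positive : ∀ a b → 0 < pair (suc a) b
  pair-suc-positive a b = s≤s z≤n

cons : ℕ → ℕ → ℕ
cons x l = suc (pair x l)

hd : ℕ → ℕ
hd l = unpair₁ (pred l)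

tl : ℕ → ℕ
tl l = unpair₂ (pred l)

consᶜ : Computable 2 (binary cons)
consᶜ = Computable-resp (λ { (_ ∷ _ ∷ []) → refl }) (comp₁ sucᶜ pairᶜ)

hdᶜ : Computable 1 (unary hd)
hdᶜ = Computable-resp (λ { (_ ∷ []) → refl }) (comp₁ unpair₁ᶜ predᶜ)

tlᶜ : Computable 1 (unary tl)
tlᶜ = Computable-resp (λ { (_ ∷ []) → refl }) (comp₁ unpair₂ᶜ predᶜ)

hd-cons : ∀ x l → hd (cons x l) ≡ x
hd-cons = unpair₁-pair

tl-cons : ∀ x l → tl (cons x l) ≡ l
tl-cons = unpair₂-pair

tl-≤ : ∀ l → tl l ≤ l
tl-≤ l = ≤-trans (unpair₂-≤ (pred l)) pred[n]≤n

opaque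
  dropₗ : ℕ → ℕ → ℕ
  dropₗ zero l = l
  dropₗ (suc i) l = tl (dropₗ i l)

  nth : ℕ → ℕ → ℕ
  nth l i = hd (dropₗ i l)

  nthᶜ : Computable 2 (binary nth)
  nthᶜ = Computable-resp (λ { (_ ∷ _ ∷ []) → refl }) (comp₁ hdᶜ (comp₂ dropₗᶜ π₁ π₀))
    where
    dropₗᶜ : Computable 2 (binary dropₗ)
    dropₗᶜ = primrec₂ dropₗ π₀ (comp₁ tlᶜ π₁) (λ _ → refl) (λ _ _ → refl)

  dropₗ-suc : ∀ i l → dropₗ (suc i) l ≡ dropₗ i (tl l)
  dropₗ-suc zero l = refl
  dropₗ-suc (suc i) l = cong tl (dropₗ-suc i l)

  nth-zero : ∀ l → nth l 0 ≡ hd l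
  nth-zero l = refl

  nth-cons-zero : ∀ x l → nth (cons x l) 0 ≡ x
  nth-cons-zero = hd-cons

  nth-cons-suc : ∀ x l i → nth (cons x l) (suc i) ≡ nth l i
  nth-cons-suc x l i rewrite dropₗ-suc i (cons x l) | tl-cons x l = refl

  nth-tl : ∀ l i → nth (tl l) i ≡ nth l (suc i)
  nth-tl l i = cong hd (sym (dropₗ-suc i l))

  nth-≤ : ∀ l i → nth l i ≤ l
  nth-≤ l i = ≤-trans (≤-trans (unpair₁-≤ _) pred[n]≤n) (dropₗ-≤ i)
    where
    dropₗ-≤ : ∀ i → dropₗ i l ≤ l
    dropₗ-≤ zero = ≤-refl
    dropₗ-≤ (suc i) = ≤-trans (tl-≤ _) (dropₗ-≤ i)

Represents : ∀ {n} → ℕ → Vec ℕ n → Set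
Represents l xs = ∀ i → nth l (toℕ i) ≡ lookup xs i

Represents-cons : ∀ {n} x l {xs : Vec ℕ n} → Represents l xs → Represents (cons x l) (x ∷ xs)
Represents-cons x l rep fzero = nth-cons-zero x l
Represents-cons x l rep (fsuc i) = trans (nth-cons-suc x l (toℕ i)) (rep i)

Represents-tl : ∀ {n} l {x} {xs : Vec ℕ n} → Represents l (x ∷ xs) → Represents (tl l) xs
Represents-tl l rep i = trans (nth-tl l (toℕ i)) (rep (fsuc i))

Represents-resp : ∀ {n} {l l′} (xs : Vec ℕ n) → l ≡ l′ → Represents l′ xs → Represents l xs
Represents-resp xs refl rep = rep

encodeVec : ∀ {n} → Vec ℕ n → ℕ
encodeVec [] = 0
encodeVec (x ∷ xs) = cons x (encodeVec xs)

encodeVec-represents : ∀ {n} (xs : Vec ℕ n) → Represents (encodeVec xs) xs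
encodeVec-represents (x ∷ xs) = Represents-cons x (encodeVec xs) (encodeVec-represents xs)

-- Computation trees

-- Tags start at 1, so that ⌜ c ⌝ > 0 = codeOf 0: a trace of a code is never 0.
mutual
  ⌜_⌝ : ∀ {n} → Code n → ℕ
  ⌜ zer ⌝ = pair 1 0
  ⌜ succ ⌝ = pair 2 0
  ⌜ proj i ⌝ = pair 3 (toℕ i)
  ⌜ comp {m = m} f gs ⌝ = pair 4 (pair m (pair ⌜ f ⌝ ⌜ gs ⌝*))
  ⌜ prec f g ⌝ = pair 5 (pair ⌜ f ⌝ ⌜ g ⌝)
  ⌜ mu f ⌝ = pair 6 ⌜ f ⌝

  ⌜_⌝* : ∀ {n m} → Vec (Code n) m → ℕ
  ⌜ [] ⌝* = 0
  ⌜ g ∷ gs ⌝* = cons ⌜ g ⌝ ⌜ gs ⌝*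

opaque
  traceNode : (code args out children : ℕ) → ℕ
  traceNode e x y l = suc (pair e (pair x (pair y l)))

  codeOf argsOf outOf childrenOf : ℕ → ℕ
  codeOf s = unpair₁ (pred s)
  argsOf s = unpair₁ (unpair₂ (pred s))
  outOf s = unpair₁ (unpair₂ (unpair₂ (pred s)))
  childrenOf s = unpair₂ (unpair₂ (unpair₂ (pred s)))

  codeOfᶜ : Computable 1 (unary codeOf)
  codeOfᶜ = Computable-resp (λ { (_ ∷ []) → refl }) (comp₁ unpair₁ᶜ predᶜ)

  argsOfᶜ : Computable 1 (unary argsOf)
  argsOfᶜ = Computable-resp (λ { (_ ∷ []) → refl }) (comp₁ unpair₁ᶜ (comp₁ unpair₂ᶜ predᶜ))

  outOfᶜ : Computable 1 (unary outOf)
  outOfᶜ = Computable-resp (λ { (_ ∷ []) → refl })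
             (comp₁ unpair₁ᶜ (comp₁ unpair₂ᶜ (comp₁ unpair₂ᶜ predᶜ)))

  childrenOfᶜ : Computable 1 (unary childrenOf)
  childrenOfᶜ = Computable-resp (λ { (_ ∷ []) → refl })
                  (comp₁ unpair₂ᶜ (comp₁ unpair₂ᶜ (comp₁ unpair₂ᶜ predᶜ)))

  traceNode-codeOf : ∀ e x y l → codeOf (traceNode e x y l) ≡ e
  traceNode-codeOf e x y l = unpair₁-pair e _

  traceNode-argsOf : ∀ e x y l → argsOf (traceNode e x y l) ≡ x
  traceNode-argsOf e x y l = trans (cong unpair₁ (unpair₂-pair e _)) (unpair₁-pair x _)

  traceNode-outOf : ∀ e x y l → outOf (traceNode e x y l) ≡ y
  traceNode-outOf e x y l =
    trans (cong (λ p → unpair₁ (unpair₂ p)) (unpair₂-pair e _))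
          (trans (cong unpair₁ (unpair₂-pair x _)) (unpair₁-pair y l))

  traceNode-childrenOf : ∀ e x y l → childrenOf (traceNode e x y l) ≡ l
  traceNode-childrenOf e x y l =
    trans (cong (λ p → unpair₂ (unpair₂ p)) (unpair₂-pair e _))
          (trans (cong unpair₂ (unpair₂-pair x _)) (unpair₂-pair y l))

  childrenOf-≤ : ∀ s → childrenOf s ≤ pred s
  childrenOf-≤ s = ≤-trans (unpair₂-≤ _) (≤-trans (unpair₂-≤ _) (unpair₂-≤ _))

  traceNode-positive : ∀ e x y l → 0 < traceNode e x y l
  traceNode-positive e x y l = s≤s z≤n

  codeOf-zero : codeOf 0 ≡ 0
  codeOf-zero = unpair₁-zero

child : ℕ → ℕ → ℕ
child s i = nth (childrenOf s) i

tagOf dataOf : ℕ → ℕ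
tagOf s = unpair₁ (codeOf s)
dataOf s = unpair₂ (codeOf s)

-- history s lists checkTrace (s ∸ 1), …, checkTrace 0, from which checkNode reads the
-- verdicts on the children of s.
verdict : (h s c : ℕ) → ℕ
verdict h s c = nth h (s ∸ suc c)

zerCheck succCheck projCheck : ℕ → ℕ
zerCheck s = eqᵇ (outOf s) 0
succCheck s = eqᵇ (outOf s) (suc (hd (argsOf s)))
projCheck s = eqᵇ (outOf s) (nth (argsOf s) (dataOf s))

compArgConds : (i s h : ℕ) → Vec ℕ 4
compArgConds i s h =
    verdict h s (child s (suc i))
  ∷ eqᵇ (codeOf (child s (suc i))) (nth (unpair₂ (unpair₂ (dataOf s))) i)
  ∷ eqᵇ (argsOf (child s (suc i))) (argsOf s)
  ∷ eqᵇ (nth (argsOf (child s 0)) i) (outOf (child s (suc i)))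
  ∷ []

compArgCheck : (i s h : ℕ) → ℕ
compArgCheck i s h = allOne (compArgConds i s h)

compConds : (s h : ℕ) → Vec ℕ 4
compConds s h =
    verdict h s (child s 0)
  ∷ eqᵇ (codeOf (child s 0)) (unpair₁ (unpair₂ (dataOf s)))
  ∷ eqᵇ (outOf (child s 0)) (outOf s)
  ∷ prod< (λ i → compArgCheck i s h) (unpair₁ (dataOf s))
  ∷ []

compCheck : (s h : ℕ) → ℕ
compCheck s h = allOne (compConds s h)

precZeroConds : (s h : ℕ) → Vec ℕ 4
precZeroConds s h =
    verdict h s (child s 0)
  ∷ eqᵇ (codeOf (child s 0)) (unpair₁ (dataOf s))
  ∷ eqᵇ (argsOf (child s 0)) (tl (argsOf s))
  ∷ eqᵇ (outOf (child s 0)) (outOf s)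
  ∷ []

precSucConds : (s h : ℕ) → Vec ℕ 7
precSucConds s h =
    verdict h s (child s 0)
  ∷ eqᵇ (codeOf (child s 0)) (codeOf s)
  ∷ eqᵇ (argsOf (child s 0)) (cons (pred (hd (argsOf s))) (tl (argsOf s)))
  ∷ verdict h s (child s 1)
  ∷ eqᵇ (codeOf (child s 1)) (unpair₂ (dataOf s))
  ∷ eqᵇ (argsOf (child s 1)) (cons (pred (hd (argsOf s))) (cons (outOf (child s 0)) (tl (argsOf s))))
  ∷ eqᵇ (outOf (child s 1)) (outOf s)
  ∷ []

precCheck : (s h : ℕ) → ℕ
precCheck s h = ifPos (hd (argsOf s)) (allOne (precSucConds s h)) (allOne (precZeroConds s h))

-- Child z evaluates the body at z; its output vanishes exactly when z = outOf s.
muStepConds : (z s h : ℕ) → Vec ℕ 4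
muStepConds z s h =
    verdict h s (child s z)
  ∷ eqᵇ (codeOf (child s z)) (dataOf s)
  ∷ eqᵇ (argsOf (child s z)) (cons z (argsOf s))
  ∷ eqᵇ (isZero (outOf (child s z))) (eqᵇ z (outOf s))
  ∷ []

muStepCheck : (z s h : ℕ) → ℕ
muStepCheck z s h = allOne (muStepConds z s h)

muCheck : (s h : ℕ) → ℕ
muCheck s h = prod< (λ z → muStepCheck z s h) (suc (outOf s))

checkByTag : (tag s h : ℕ) → ℕ
checkByTag 1 s h = zerCheck s
checkByTag 2 s h = succCheck s
checkByTag 3 s h = projCheck s
checkByTag 4 s h = compCheck s h
checkByTag 5 s h = precCheck s h
checkByTag 6 s h = muCheck s h
checkByTag _ s h = 0

checkNode : (s h : ℕ) → ℕ
checkNode s h = checkByTag (tagOf s) s h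

history : ℕ → ℕ
history zero = 0
history (suc s) = cons (checkNode s (history s)) (history s)

checkTrace : ℕ → ℕ
checkTrace s = checkNode s (history s)

childᶜ : Computable 2 (binary child)
childᶜ = Computable-resp (λ { (_ ∷ _ ∷ []) → refl }) (comp₂ nthᶜ (comp₁ childrenOfᶜ π₀) π₁)

tagOfᶜ : Computable 1 (unary tagOf)
tagOfᶜ = Computable-resp (λ { (_ ∷ []) → refl }) (comp₁ unpair₁ᶜ codeOfᶜ)

dataOfᶜ : Computable 1 (unary dataOf)
dataOfᶜ = Computable-resp (λ { (_ ∷ []) → refl }) (comp₁ unpair₂ᶜ codeOfᶜ)

verdictᶜ : Computable 3 (ternary verdict)
verdictᶜ = Computable-resp (λ { (_ ∷ _ ∷ _ ∷ []) → refl })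
             (comp₂ nthᶜ π₀ (comp₂ monusᶜ π₁ (comp₁ sucᶜ π₂)))

zerCheckᶜ : Computable 1 (unary zerCheck)
zerCheckᶜ = Computable-resp (λ { (_ ∷ []) → refl }) (comp₂ eqᵇᶜ outOfᶜ zeroᶜ)

succCheckᶜ : Computable 1 (unary succCheck)
succCheckᶜ = Computable-resp (λ { (_ ∷ []) → refl })
               (comp₂ eqᵇᶜ outOfᶜ (comp₁ sucᶜ (comp₁ hdᶜ argsOfᶜ)))

projCheckᶜ : Computable 1 (unary projCheck)
projCheckᶜ = Computable-resp (λ { (_ ∷ []) → refl })
               (comp₂ eqᵇᶜ outOfᶜ (comp₂ nthᶜ argsOfᶜ dataOfᶜ))

compArgCheckᶜ : Computable 3 (ternary compArgCheck)
compArgCheckᶜ = Computable-resp (λ { (_ ∷ _ ∷ _ ∷ []) → refl }) (allOneᶜ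
  ( comp₃ verdictᶜ π₂ π₁ argChild
  ∷ comp₂ eqᵇᶜ (comp₁ codeOfᶜ argChild)
      (comp₂ nthᶜ (comp₁ unpair₂ᶜ (comp₁ unpair₂ᶜ (comp₁ dataOfᶜ π₁))) π₀)
  ∷ comp₂ eqᵇᶜ (comp₁ argsOfᶜ argChild) (comp₁ argsOfᶜ π₁)
  ∷ comp₂ eqᵇᶜ (comp₂ nthᶜ (comp₁ argsOfᶜ (comp₂ childᶜ π₁ zeroᶜ)) π₀) (comp₁ outOfᶜ argChild)
  ∷ []))
  where
  argChild : Computable 3 (λ { (i ∷ s ∷ _ ∷ []) → child s (suc i) })
  argChild = Computable-resp (λ { (_ ∷ _ ∷ _ ∷ []) → refl }) (comp₂ childᶜ π₁ (comp₁ sucᶜ π₀))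

child₀ᶜ : Computable 2 (λ { (s ∷ _ ∷ []) → child s 0 })
child₀ᶜ = Computable-resp (λ { (_ ∷ _ ∷ []) → refl }) (comp₂ childᶜ π₀ zeroᶜ)

child₁ᶜ : Computable 2 (λ { (s ∷ _ ∷ []) → child s 1 })
child₁ᶜ = Computable-resp (λ { (_ ∷ _ ∷ []) → refl }) (comp₂ childᶜ π₀ (constᶜ 1))

compCheckᶜ : Computable 2 (binary compCheck)
compCheckᶜ = Computable-resp (λ { (_ ∷ _ ∷ []) → refl }) (allOneᶜ
  ( comp₃ verdictᶜ π₁ π₀ child₀ᶜ
  ∷ comp₂ eqᵇᶜ (comp₁ codeOfᶜ child₀ᶜ) (comp₁ unpair₁ᶜ (comp₁ unpair₂ᶜ (comp₁ dataOfᶜ π₀)))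
  ∷ comp₂ eqᵇᶜ (comp₁ outOfᶜ child₀ᶜ) (comp₁ outOfᶜ π₀)
  ∷ comp₃ (prod<ᶜ compArgCheckᶜ) (comp₁ unpair₁ᶜ (comp₁ dataOfᶜ π₀)) π₀ π₁
  ∷ []))

precCheckᶜ : Computable 2 (binary precCheck)
precCheckᶜ = Computable-resp (λ { (_ ∷ _ ∷ []) → refl })
  (comp₃ ifPosᶜ (comp₁ hdᶜ (comp₁ argsOfᶜ π₀)) precSucCheckᶜ precZeroCheckᶜ)
  where
  rest : Computable 2 (λ { (s ∷ _ ∷ []) → tl (argsOf s) })
  rest = Computable-resp (λ { (_ ∷ _ ∷ []) → refl }) (comp₁ tlᶜ (comp₁ argsOfᶜ π₀))
  counter : Computable 2 (λ { (s ∷ _ ∷ []) → pred (hd (argsOf s)) })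
  counter = Computable-resp (λ { (_ ∷ _ ∷ []) → refl }) (comp₁ predᶜ (comp₁ hdᶜ (comp₁ argsOfᶜ π₀)))
  precZeroCheckᶜ : Computable 2 (λ { (s ∷ h ∷ []) → allOne (precZeroConds s h) })
  precZeroCheckᶜ = Computable-resp (λ { (_ ∷ _ ∷ []) → refl }) (allOneᶜ
    ( comp₃ verdictᶜ π₁ π₀ child₀ᶜ
    ∷ comp₂ eqᵇᶜ (comp₁ codeOfᶜ child₀ᶜ) (comp₁ unpair₁ᶜ (comp₁ dataOfᶜ π₀))
    ∷ comp₂ eqᵇᶜ (comp₁ argsOfᶜ child₀ᶜ) rest
    ∷ comp₂ eqᵇᶜ (comp₁ outOfᶜ child₀ᶜ) (comp₁ outOfᶜ π₀)
    ∷ []))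
  precSucCheckᶜ : Computable 2 (λ { (s ∷ h ∷ []) → allOne (precSucConds s h) })
  precSucCheckᶜ = Computable-resp (λ { (_ ∷ _ ∷ []) → refl }) (allOneᶜ
    ( comp₃ verdictᶜ π₁ π₀ child₀ᶜ
    ∷ comp₂ eqᵇᶜ (comp₁ codeOfᶜ child₀ᶜ) (comp₁ codeOfᶜ π₀)
    ∷ comp₂ eqᵇᶜ (comp₁ argsOfᶜ child₀ᶜ) (comp₂ consᶜ counter rest)
    ∷ comp₃ verdictᶜ π₁ π₀ child₁ᶜ
    ∷ comp₂ eqᵇᶜ (comp₁ codeOfᶜ child₁ᶜ) (comp₁ unpair₂ᶜ (comp₁ dataOfᶜ π₀))
    ∷ comp₂ eqᵇᶜ (comp₁ argsOfᶜ child₁ᶜ)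
        (comp₂ consᶜ counter (comp₂ consᶜ (comp₁ outOfᶜ child₀ᶜ) rest))
    ∷ comp₂ eqᵇᶜ (comp₁ outOfᶜ child₁ᶜ) (comp₁ outOfᶜ π₀)
    ∷ []))

muStepCheckᶜ : Computable 3 (ternary muStepCheck)
muStepCheckᶜ = Computable-resp (λ { (_ ∷ _ ∷ _ ∷ []) → refl }) (allOneᶜ
  ( comp₃ verdictᶜ π₂ π₁ stepChild
  ∷ comp₂ eqᵇᶜ (comp₁ codeOfᶜ stepChild) (comp₁ dataOfᶜ π₁)
  ∷ comp₂ eqᵇᶜ (comp₁ argsOfᶜ stepChild) (comp₂ consᶜ π₀ (comp₁ argsOfᶜ π₁))
  ∷ comp₂ eqᵇᶜ (comp₁ isZeroᶜ (comp₁ outOfᶜ stepChild)) (comp₂ eqᵇᶜ π₀ (comp₁ outOfᶜ π₁))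
  ∷ []))
  where
  stepChild : Computable 3 (λ { (z ∷ s ∷ _ ∷ []) → child s z })
  stepChild = Computable-resp (λ { (_ ∷ _ ∷ _ ∷ []) → refl }) (comp₂ childᶜ π₁ π₀)

muCheckᶜ : Computable 2 (binary muCheck)
muCheckᶜ = Computable-resp (λ { (_ ∷ _ ∷ []) → refl })
  (comp₃ (prod<ᶜ muStepCheckᶜ) (comp₁ sucᶜ (comp₁ outOfᶜ π₀)) π₀ π₁)

checkByTag-as-sum : ∀ t s h → checkByTag t s h ≡
  eqᵇ t 1 * zerCheck s + (eqᵇ t 2 * succCheck s + (eqᵇ t 3 * projCheck s +
  (eqᵇ t 4 * compCheck s h + (eqᵇ t 5 * precCheck s h + eqᵇ t 6 * muCheck s h))))
checkByTag-as-sum 0 s h = refl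
checkByTag-as-sum 1 s h = sym (trans (+-identityʳ _) (+-identityʳ _))
checkByTag-as-sum 2 s h = sym (trans (+-identityʳ _) (+-identityʳ _))
checkByTag-as-sum 3 s h = sym (trans (+-identityʳ _) (+-identityʳ _))
checkByTag-as-sum 4 s h = sym (trans (+-identityʳ _) (+-identityʳ _))
checkByTag-as-sum 5 s h = sym (trans (+-identityʳ _) (+-identityʳ _))
checkByTag-as-sum 6 s h = sym (+-identityʳ _)
checkByTag-as-sum (suc (suc (suc (suc (suc (suc (suc t))))))) s h = refl

checkNodeᶜ : Computable 2 (binary checkNode)
checkNodeᶜ = Computable-resp (λ { (s ∷ h ∷ []) → sym (checkByTag-as-sum (tagOf s) s h) })
  (comp₂ addᶜ (summand 1 (comp₁ zerCheckᶜ π₀)) (comp₂ addᶜ (summand 2 (comp₁ succCheckᶜ π₀))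
  (comp₂ addᶜ (summand 3 (comp₁ projCheckᶜ π₀)) (comp₂ addᶜ (summand 4 compCheckᶜ)
  (comp₂ addᶜ (summand 5 precCheckᶜ) (summand 6 muCheckᶜ))))))
  where
  summand : ∀ t {f : Fn 2} → Computable 2 f →
            Computable 2 (λ { (s ∷ h ∷ []) → eqᵇ (tagOf s) t * f (s ∷ h ∷ []) })
  summand t F = Computable-resp (λ { (_ ∷ _ ∷ []) → refl })
                  (comp₂ mulᶜ (comp₂ eqᵇᶜ (comp₁ tagOfᶜ π₀) (constᶜ t)) F)

historyᶜ : Computable 1 (unary history)
historyᶜ = primrec₁ history (comp₂ consᶜ (comp₂ checkNodeᶜ π₀ π₁) π₁) (λ _ → refl)

checkTraceᶜ : Computable 1 (unary checkTrace)
checkTraceᶜ = Computable-resp (λ { (_ ∷ []) → refl }) (comp₂ checkNodeᶜ π₀ historyᶜ)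

verdict-history : ∀ {s c} → c < s → verdict (history s) s c ≡ checkTrace c
verdict-history {suc s} {c} (s≤s c≤s) with m≤n⇒m<n∨m≡n c≤s
... | inj₂ refl = trans (cong (nth (history (suc c))) (n∸n≡0 c)) (nth-cons-zero _ (history c))
... | inj₁ c<s = trans (cong (nth (history (suc s))) (+-∸-assoc 1 c<s))
                   (trans (nth-cons-suc _ (history s) (s ∸ suc c)) (verdict-history c<s))

child-< : ∀ {s} i → 0 < s → child s i < s
child-< {suc s} i _ = s≤s (≤-trans (nth-≤ _ i) (childrenOf-≤ (suc s)))

⌜⌝-positive : ∀ {n} (c : Code n) → 0 < ⌜ c ⌝
⌜⌝-positive zer = pair-suc-positive 0 0
⌜⌝-positive succ = pair-suc-positive 1 0
⌜⌝-positive (proj i) = pair-suc-positive 2 _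
⌜⌝-positive (comp f gs) = pair-suc-positive 3 _
⌜⌝-positive (prec f g) = pair-suc-positive 4 _
⌜⌝-positive (mu f) = pair-suc-positive 5 _

trace-positive : ∀ {s n} {c : Code n} → codeOf s ≡ ⌜ c ⌝ → 0 < s
trace-positive {zero} {c = c} code = ⊥-elim (<⇒≢ (⌜⌝-positive c) (trans (sym codeOf-zero) code))
trace-positive {suc s} _ = s≤s z≤n

nth-⌜⌝* : ∀ {n m} (gs : Vec (Code n) m) (j : Fin m) → nth ⌜ gs ⌝* (toℕ j) ≡ ⌜ lookup gs j ⌝
nth-⌜⌝* (g ∷ gs) fzero = nth-cons-zero _ _
nth-⌜⌝* (g ∷ gs) (fsuc j) = trans (nth-cons-suc _ _ _) (nth-⌜⌝* gs j)

EvalAll-tabulate : ∀ {n m} (gs : Vec (Code n) m) {xs} (f : Fin m → ℕ) →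
                   (∀ j → Eval (lookup gs j) xs (f j)) → EvalAll gs xs (tabulate f)
EvalAll-tabulate [] f ev = []
EvalAll-tabulate (g ∷ gs) f ev = ev fzero ∷ EvalAll-tabulate gs (λ j → f (fsuc j)) (λ j → ev (fsuc j))

comp-payload : ∀ {s} m fe ge → dataOf s ≡ pair m (pair fe ge) →
  unpair₁ (dataOf s) ≡ m × unpair₁ (unpair₂ (dataOf s)) ≡ fe × unpair₂ (unpair₂ (dataOf s)) ≡ ge
comp-payload m fe ge payload =
    trans (cong unpair₁ payload) (unpair₁-pair m _)
  , trans (cong (λ d → unpair₁ (unpair₂ d)) payload)
      (trans (cong unpair₁ (unpair₂-pair m _)) (unpair₁-pair fe ge))
  , trans (cong (λ d → unpair₂ (unpair₂ d)) payload)
      (trans (cong unpair₂ (unpair₂-pair m _)) (unpair₂-pair fe ge))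

Sound : ℕ → Set
Sound s = ∀ {n} (c : Code n) xs → codeOf s ≡ ⌜ c ⌝ → Represents (argsOf s) xs → Eval c xs (outOf s)

ChildrenSound : ℕ → Set
ChildrenSound s = ∀ i → verdict (history s) s (child s i) ≡ 1 → Sound (child s i)

sound-comp : ∀ s {n m} (f : Code m) (gs : Vec (Code n) m) xs → ChildrenSound s →
             dataOf s ≡ pair m (pair ⌜ f ⌝ ⌜ gs ⌝*) → Represents (argsOf s) xs →
             compCheck s (history s) ≡ 1 → Eval (comp f gs) xs (outOf s)
sound-comp s {m = m} f gs xs sound d rep check
  with allOne≡1⇒All (compConds s (history s)) check
... | v₀ ∷ code₀ ∷ out₀ ∷ args ∷ [] =
  ev-comp (EvalAll-tabulate gs argOut evalArg)
          (subst (Eval f ys) (eqᵇ≡1⇒≡ out₀) (sound 0 v₀ f ys fCode argsRep))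
  where
  argOut : Fin m → ℕ
  argOut j = outOf (child s (suc (toℕ j)))
  ys : Vec ℕ m
  ys = tabulate argOut
  arity : unpair₁ (dataOf s) ≡ m
  arity = proj₁ (comp-payload m ⌜ f ⌝ ⌜ gs ⌝* d)
  gsCode : unpair₂ (unpair₂ (dataOf s)) ≡ ⌜ gs ⌝*
  gsCode = proj₂ (proj₂ (comp-payload m ⌜ f ⌝ ⌜ gs ⌝* d))
  fCode : codeOf (child s 0) ≡ ⌜ f ⌝
  fCode = trans (eqᵇ≡1⇒≡ code₀) (proj₁ (proj₂ (comp-payload m ⌜ f ⌝ ⌜ gs ⌝* d)))
  argCheck : ∀ j → All (_≡ 1) (compArgConds (toℕ j) s (history s))
  argCheck j = allOne≡1⇒All (compArgConds (toℕ j) s (history s)) (prod<≡1⇒ (λ i → compArgCheck i s (history s)) m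
                 (subst (λ k → prod< _ k ≡ 1) arity args) (toℕ j) (toℕ<n j))
  evalArg : ∀ j → Eval (lookup gs j) xs (argOut j)
  evalArg j with argCheck j
  ... | vⱼ ∷ codeⱼ ∷ argsⱼ ∷ _ ∷ [] =
    sound (suc (toℕ j)) vⱼ (lookup gs j) xs
      (trans (eqᵇ≡1⇒≡ codeⱼ) (trans (cong (λ l → nth l (toℕ j)) gsCode) (nth-⌜⌝* gs j)))
      (Represents-resp xs (eqᵇ≡1⇒≡ argsⱼ) rep)
  argsRep : Represents (argsOf (child s 0)) ys
  argsRep j with argCheck j
  ... | _ ∷ _ ∷ _ ∷ outⱼ ∷ [] = trans (eqᵇ≡1⇒≡ outⱼ) (sym (lookup∘tabulate argOut j))

tagOf-code : ∀ {s t p} → codeOf s ≡ pair t p → tagOf s ≡ t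
tagOf-code {t = t} {p} code = trans (cong unpair₁ code) (unpair₁-pair t p)

dataOf-code : ∀ {s t p} → codeOf s ≡ pair t p → dataOf s ≡ p
dataOf-code {t = t} {p} code = trans (cong unpair₂ code) (unpair₂-pair t p)

checkTrace-code : ∀ {s t p} → codeOf s ≡ pair t p → checkTrace s ≡ checkByTag t s (history s)
checkTrace-code {s} code = cong (λ t → checkByTag t s (history s)) (tagOf-code code)

hd-represents : ∀ {n} l {x} {xs : Vec ℕ n} → Represents l (x ∷ xs) → hd l ≡ x
hd-represents l rep = trans (sym (nth-zero l)) (rep fzero)

precCheck-zero : ∀ {s h} → hd (argsOf s) ≡ 0 → precCheck s h ≡ 1 → allOne (precZeroConds s h) ≡ 1
precCheck-zero {s} {h} hd≡0 check =
  trans (sym (ifPos-zero (allOne (precSucConds s h)) _))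
        (subst (λ c → ifPos c (allOne (precSucConds s h)) (allOne (precZeroConds s h)) ≡ 1) hd≡0 check)

precCheck-suc : ∀ {s h k} → hd (argsOf s) ≡ suc k → precCheck s h ≡ 1 → allOne (precSucConds s h) ≡ 1
precCheck-suc {s} {h} {k} hd≡1+k check =
  trans (sym (ifPos-suc k _ (allOne (precZeroConds s h))))
        (subst (λ c → ifPos c (allOne (precSucConds s h)) (allOne (precZeroConds s h)) ≡ 1) hd≡1+k check)

sound-prec-zero : ∀ s {n} (f : Code n) g xs → ChildrenSound s → codeOf s ≡ ⌜ prec f g ⌝ →
                  Represents (argsOf s) (0 ∷ xs) → precCheck s (history s) ≡ 1 →
                  Eval (prec f g) (0 ∷ xs) (outOf s)
sound-prec-zero s f g xs sound code rep check
  with allOne≡1⇒All (precZeroConds s (history s))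
         (precCheck-zero (hd-represents (argsOf s) rep) check)
... | v₀ ∷ code₀ ∷ args₀ ∷ out₀ ∷ [] =
  ev-prec-z (subst (Eval f xs) (eqᵇ≡1⇒≡ out₀) (sound 0 v₀ f xs
    (trans (eqᵇ≡1⇒≡ code₀) (trans (cong unpair₁ (dataOf-code code)) (unpair₁-pair _ _)))
    (Represents-resp xs (eqᵇ≡1⇒≡ args₀) (Represents-tl (argsOf s) rep))))

sound-prec-suc : ∀ s {n} (f : Code n) g k xs → ChildrenSound s → codeOf s ≡ ⌜ prec f g ⌝ →
                 Represents (argsOf s) (suc k ∷ xs) → precCheck s (history s) ≡ 1 →
                 Eval (prec f g) (suc k ∷ xs) (outOf s)
sound-prec-suc s f g k xs sound code rep check
  with allOne≡1⇒All (precSucConds s (history s))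
         (precCheck-suc (hd-represents (argsOf s) rep) check)
... | v₀ ∷ code₀ ∷ args₀ ∷ v₁ ∷ code₁ ∷ args₁ ∷ out₁ ∷ [] =
  ev-prec-s previous (subst (Eval g _) (eqᵇ≡1⇒≡ out₁) (sound 1 v₁ g (k ∷ r ∷ xs)
    (trans (eqᵇ≡1⇒≡ code₁) (trans (cong unpair₂ (dataOf-code code)) (unpair₂-pair _ _)))
    (Represents-resp (k ∷ r ∷ xs) (trans (eqᵇ≡1⇒≡ args₁) (cong (λ c → cons c (cons r (tl (argsOf s)))) counter))
       (Represents-cons k _ (Represents-cons r (tl (argsOf s)) rest)))))
  where
  r : ℕ
  r = outOf (child s 0)
  counter : pred (hd (argsOf s)) ≡ k
  counter = cong pred (hd-represents _ rep)
  rest : Represents (tl (argsOf s)) xs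
  rest = Represents-tl (argsOf s) rep
  previous : Eval (prec f g) (k ∷ xs) r
  previous = sound 0 v₀ (prec f g) (k ∷ xs) (trans (eqᵇ≡1⇒≡ code₀) code)
    (Represents-resp (k ∷ xs) (trans (eqᵇ≡1⇒≡ args₀) (cong (λ c → cons c (tl (argsOf s))) counter))
       (Represents-cons k (tl (argsOf s)) rest))

sound-mu : ∀ s {n} (f : Code (suc n)) xs → ChildrenSound s → codeOf s ≡ ⌜ mu f ⌝ →
           Represents (argsOf s) xs → muCheck s (history s) ≡ 1 → Eval (mu f) xs (outOf s)
sound-mu s f xs sound code rep check =
  ev-mu (subst (Eval f _) (isZero≡1⇒≡0 (trans (isZero-out ≤-refl) (eqᵇ-refl (outOf s)))) (eval ≤-refl))
        (λ z z<y → pred (outOf (child s z)) ,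
          subst (Eval f _) (isZero≡0⇒≡suc (trans (isZero-out (<⇒≤ z<y)) (≢⇒eqᵇ≡0 (<⇒≢ z<y))))
            (eval (<⇒≤ z<y)))
  where
  stepConds : ∀ {z} → z ≤ outOf s → All (_≡ 1) (muStepConds z s (history s))
  stepConds {z} z≤y = allOne≡1⇒All (muStepConds z s (history s))
                        (prod<≡1⇒ (λ z → muStepCheck z s (history s)) _ check z (s≤s z≤y))
  isZero-out : ∀ {z} → z ≤ outOf s → isZero (outOf (child s z)) ≡ eqᵇ z (outOf s)
  isZero-out z≤y with stepConds z≤y
  ... | _ ∷ _ ∷ _ ∷ zeroAt ∷ [] = eqᵇ≡1⇒≡ zeroAt
  eval : ∀ {z} → z ≤ outOf s → Eval f (z ∷ xs) (outOf (child s z))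
  eval {z} z≤y with stepConds z≤y
  ... | v ∷ codeᶻ ∷ argsᶻ ∷ _ ∷ [] = sound z v f (z ∷ xs)
    (trans (eqᵇ≡1⇒≡ codeᶻ) (dataOf-code code))
    (Represents-resp (z ∷ xs) (eqᵇ≡1⇒≡ argsᶻ) (Represents-cons z (argsOf s) rep))

sound-node : ∀ s → ChildrenSound s → checkTrace s ≡ 1 → Sound s
sound-node s sound check zer xs code rep =
  subst (Eval zer xs) (sym (eqᵇ≡1⇒≡ (trans (sym (checkTrace-code code)) check))) ev-zer
sound-node s sound check succ (x ∷ []) code rep =
  subst (Eval succ (x ∷ []))
    (sym (trans (eqᵇ≡1⇒≡ (trans (sym (checkTrace-code code)) check)) (cong suc (hd-represents _ rep))))
    ev-succ
sound-node s sound check (proj i) xs code rep =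
  subst (Eval (proj i) xs)
    (sym (trans (eqᵇ≡1⇒≡ (trans (sym (checkTrace-code code)) check))
                (trans (cong (nth (argsOf s)) (dataOf-code code)) (rep i))))
    ev-proj
sound-node s sound check (comp f gs) xs code rep =
  sound-comp s f gs xs sound (dataOf-code code) rep (trans (sym (checkTrace-code code)) check)
sound-node s sound check (prec f g) (zero ∷ xs) code rep =
  sound-prec-zero s f g xs sound code rep (trans (sym (checkTrace-code code)) check)
sound-node s sound check (prec f g) (suc k ∷ xs) code rep =
  sound-prec-suc s f g k xs sound code rep (trans (sym (checkTrace-code code)) check)
sound-node s sound check (mu f) xs code rep =
  sound-mu s f xs sound code rep (trans (sym (checkTrace-code code)) check)

checkTrace-sound : ∀ s → checkTrace s ≡ 1 → Sound s
checkTrace-sound = <-rec (λ s → checkTrace s ≡ 1 → Sound s) λ s rec check c xs code →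
  let children-< = λ i → child-< i (trace-positive {c = c} code)
  in sound-node s (λ i v → rec (children-< i) (trans (sym (verdict-history (children-< i))) v))
                check c xs code

IsTraceOf : ∀ {n} → ℕ → Code n → Vec ℕ n → ℕ → Set
IsTraceOf s c xs y = checkTrace s ≡ 1 × codeOf s ≡ ⌜ c ⌝ × argsOf s ≡ encodeVec xs × outOf s ≡ y

verdict-child : ∀ {s} i → 0 < s → checkTrace (child s i) ≡ 1 → verdict (history s) s (child s i) ≡ 1
verdict-child i pos check = trans (verdict-history (child-< i pos)) check

complete-comp : ∀ s {n m} (f : Code m) (gs : Vec (Code n) m) xs ys y → 0 < s →
  codeOf s ≡ ⌜ comp f gs ⌝ → argsOf s ≡ encodeVec xs → outOf s ≡ y →
  IsTraceOf (child s 0) f ys y →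
  (∀ j → IsTraceOf (child s (suc (toℕ j))) (lookup gs j) xs (lookup ys j)) →
  checkTrace s ≡ 1
complete-comp s {m = m} f gs xs ys y pos code args out (check₀ , code₀ , args₀ , out₀) argTrace =
  trans (checkTrace-code code) (All⇒allOne≡1 (compConds s (history s))
    ( verdict-child 0 pos check₀
    ∷ ≡⇒eqᵇ≡1 (trans code₀ (sym fCode))
    ∷ ≡⇒eqᵇ≡1 (trans out₀ (sym out))
    ∷ subst (λ k → prod< (λ i → compArgCheck i s (history s)) k ≡ 1) (sym arity)
        (⇒prod<≡1 _ m λ i i<m → subst (λ i → compArgCheck i s (history s) ≡ 1)
           (toℕ-fromℕ< i<m) (argCheck (fromℕ< i<m)))
    ∷ []))
  where
  arity : unpair₁ (dataOf s) ≡ m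
  arity = proj₁ (comp-payload m ⌜ f ⌝ ⌜ gs ⌝* (dataOf-code code))
  fCode : unpair₁ (unpair₂ (dataOf s)) ≡ ⌜ f ⌝
  fCode = proj₁ (proj₂ (comp-payload m ⌜ f ⌝ ⌜ gs ⌝* (dataOf-code code)))
  gsCode : unpair₂ (unpair₂ (dataOf s)) ≡ ⌜ gs ⌝*
  gsCode = proj₂ (proj₂ (comp-payload m ⌜ f ⌝ ⌜ gs ⌝* (dataOf-code code)))
  argCheck : ∀ j → compArgCheck (toℕ j) s (history s) ≡ 1
  argCheck j with argTrace j
  ... | checkⱼ , codeⱼ , argsⱼ , outⱼ = All⇒allOne≡1 (compArgConds (toℕ j) s (history s))
    ( verdict-child (suc (toℕ j)) pos checkⱼ
    ∷ ≡⇒eqᵇ≡1 (trans codeⱼ (sym (trans (cong (λ l → nth l (toℕ j)) gsCode) (nth-⌜⌝* gs j))))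
    ∷ ≡⇒eqᵇ≡1 (trans argsⱼ (sym args))
    ∷ ≡⇒eqᵇ≡1 (trans (cong (λ l → nth l (toℕ j)) args₀) (trans (encodeVec-represents ys j) (sym outⱼ)))
    ∷ [])

complete-prec-zero : ∀ s {n} (f : Code n) g xs y → 0 < s →
  codeOf s ≡ ⌜ prec f g ⌝ → argsOf s ≡ encodeVec (0 ∷ xs) → outOf s ≡ y →
  IsTraceOf (child s 0) f xs y → checkTrace s ≡ 1
complete-prec-zero s f g xs y pos code args out (check₀ , code₀ , args₀ , out₀) =
  trans (checkTrace-code code)
    (trans (cong (λ c → ifPos c (allOne (precSucConds s (history s))) (allOne (precZeroConds s (history s))))
                 (trans (cong hd args) (hd-cons 0 _)))
    (trans (ifPos-zero _ _) (All⇒allOne≡1 (precZeroConds s (history s))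
      ( verdict-child 0 pos check₀
      ∷ ≡⇒eqᵇ≡1 (trans code₀ (sym (trans (cong unpair₁ (dataOf-code code)) (unpair₁-pair _ _))))
      ∷ ≡⇒eqᵇ≡1 (trans args₀ (sym (trans (cong tl args) (tl-cons 0 _))))
      ∷ ≡⇒eqᵇ≡1 (trans out₀ (sym out))
      ∷ []))))

complete-prec-suc : ∀ s {n} (f : Code n) g k xs r y → 0 < s →
  codeOf s ≡ ⌜ prec f g ⌝ → argsOf s ≡ encodeVec (suc k ∷ xs) → outOf s ≡ y →
  IsTraceOf (child s 0) (prec f g) (k ∷ xs) r → IsTraceOf (child s 1) g (k ∷ r ∷ xs) y →
  checkTrace s ≡ 1
complete-prec-suc s f g k xs r y pos code args out
  (check₀ , code₀ , args₀ , out₀) (check₁ , code₁ , args₁ , out₁) =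
  trans (checkTrace-code code)
    (trans (cong (λ c → ifPos c (allOne (precSucConds s (history s))) (allOne (precZeroConds s (history s))))
                 hd≡1+k)
    (trans (ifPos-suc k _ _) (All⇒allOne≡1 (precSucConds s (history s))
      ( verdict-child 0 pos check₀
      ∷ ≡⇒eqᵇ≡1 (trans code₀ (sym code))
      ∷ ≡⇒eqᵇ≡1 (trans args₀ (sym (cong₂ cons counter rest)))
      ∷ verdict-child 1 pos check₁
      ∷ ≡⇒eqᵇ≡1 (trans code₁ (sym (trans (cong unpair₂ (dataOf-code code)) (unpair₂-pair _ _))))
      ∷ ≡⇒eqᵇ≡1 (trans args₁ (sym (cong₂ cons counter (cong₂ cons out₀ rest))))
      ∷ ≡⇒eqᵇ≡1 (trans out₁ (sym out))
      ∷ []))))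
  where
  hd≡1+k : hd (argsOf s) ≡ suc k
  hd≡1+k = trans (cong hd args) (hd-cons (suc k) _)
  counter : pred (hd (argsOf s)) ≡ k
  counter = cong pred hd≡1+k
  rest : tl (argsOf s) ≡ encodeVec xs
  rest = trans (cong tl args) (tl-cons (suc k) _)

MuStepTrace : ∀ {n} → Code (suc n) → Vec ℕ n → (y z s : ℕ) → Set
MuStepTrace f xs y z s =
  checkTrace s ≡ 1 × codeOf s ≡ ⌜ f ⌝ × argsOf s ≡ encodeVec (z ∷ xs) ×
  isZero (outOf s) ≡ eqᵇ z y

complete-mu : ∀ s {n} (f : Code (suc n)) xs y → 0 < s →
  codeOf s ≡ ⌜ mu f ⌝ → argsOf s ≡ encodeVec xs → outOf s ≡ y →
  (∀ z → z ≤ y → MuStepTrace f xs y z (child s z)) → checkTrace s ≡ 1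
complete-mu s f xs y pos code args out stepTrace =
  trans (checkTrace-code code) (⇒prod<≡1 _ (suc (outOf s)) stepCheck)
  where
  stepCheck : ∀ z → z < suc (outOf s) → muStepCheck z s (history s) ≡ 1
  stepCheck z (s≤s z≤y) with stepTrace z (subst (z ≤_) out z≤y)
  ... | checkᶻ , codeᶻ , argsᶻ , zeroAt = All⇒allOne≡1 (muStepConds z s (history s))
    ( verdict-child z pos checkᶻ
    ∷ ≡⇒eqᵇ≡1 (trans codeᶻ (sym (dataOf-code code)))
    ∷ ≡⇒eqᵇ≡1 (trans argsᶻ (sym (cong (cons z) args)))
    ∷ ≡⇒eqᵇ≡1 (trans zeroAt (cong (eqᵇ z) (sym out)))
    ∷ [])

traceNode-child : ∀ e x y l i → child (traceNode e x y l) i ≡ nth l i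
traceNode-child e x y l i = cong (λ l → nth l i) (traceNode-childrenOf e x y l)

node-IsTraceOf : ∀ {n} (c : Code n) xs y l → checkTrace (traceNode ⌜ c ⌝ (encodeVec xs) y l) ≡ 1 →
                 IsTraceOf (traceNode ⌜ c ⌝ (encodeVec xs) y l) c xs y
node-IsTraceOf c xs y l check =
  check , traceNode-codeOf _ _ _ _ , traceNode-argsOf _ _ _ _ , traceNode-outOf _ _ _ _

finiteChoice : ∀ k (P : ℕ → ℕ → Set) → (∀ z → z < k → Σ ℕ (P z)) →
               Σ ℕ λ l → ∀ z → z < k → P z (nth l z)
finiteChoice zero P choose = 0 , λ _ ()
finiteChoice (suc k) P choose
  with finiteChoice k (λ z → P (suc z)) (λ z z<k → choose (suc z) (s≤s z<k)) | choose 0 (s≤s z≤n)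
... | l , inL | a , Pa = cons a l , λ
  { zero _ → subst (P 0) (sym (nth-cons-zero a l)) Pa
  ; (suc z) (s≤s z<k) → subst (P (suc z)) (sym (nth-cons-suc a l z)) (inL z z<k) }

mutual
  complete : ∀ {n} {c : Code n} {xs y} → Eval c xs y → Σ ℕ λ s → IsTraceOf s c xs y
  complete {c = c} {xs} {y} ev-zer =
    _ , node-IsTraceOf c xs y 0 (trans (checkTrace-code (traceNode-codeOf _ _ _ _))
                                       (≡⇒eqᵇ≡1 (traceNode-outOf _ _ _ _)))
  complete {c = c} {x ∷ []} {y} ev-succ =
    _ , node-IsTraceOf c (x ∷ []) y 0 (trans (checkTrace-code (traceNode-codeOf _ _ _ _))
          (≡⇒eqᵇ≡1 (trans (traceNode-outOf _ _ _ _)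
                          (cong suc (sym (trans (cong hd (traceNode-argsOf _ _ _ _)) (hd-cons x 0)))))))
  complete {c = proj i} {xs} {y} ev-proj =
    _ , node-IsTraceOf (proj i) xs y 0 (trans (checkTrace-code (traceNode-codeOf _ _ _ _))
          (≡⇒eqᵇ≡1 (trans (traceNode-outOf _ _ _ _)
            (sym (trans (cong₂ nth (traceNode-argsOf _ _ _ _) (dataOf-code (traceNode-codeOf _ _ _ _)))
                        (encodeVec-represents xs i))))))
  complete {c = comp f gs} {xs} {y} (ev-comp {ys = ys} evs ev) with completeAll evs | complete ev
  ... | l , argTrace | t , trace =
    _ , node-IsTraceOf (comp f gs) xs y (cons t l)
          (complete-comp _ f gs xs ys y (traceNode-positive _ _ _ _)
            (traceNode-codeOf _ _ _ _) (traceNode-argsOf _ _ _ _) (traceNode-outOf _ _ _ _)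
            (subst (λ t → IsTraceOf t f ys y)
               (sym (trans (traceNode-child _ _ _ _ 0) (nth-cons-zero t l))) trace)
            (λ j → subst (λ t → IsTraceOf t (lookup gs j) xs (lookup ys j))
               (sym (trans (traceNode-child _ _ _ _ (suc (toℕ j))) (nth-cons-suc t l (toℕ j))))
               (argTrace j)))
  complete {c = prec f g} {zero ∷ xs} {y} (ev-prec-z ev) with complete ev
  ... | t , trace =
    _ , node-IsTraceOf (prec f g) (0 ∷ xs) y (cons t 0)
          (complete-prec-zero _ f g xs y (traceNode-positive _ _ _ _)
            (traceNode-codeOf _ _ _ _) (traceNode-argsOf _ _ _ _) (traceNode-outOf _ _ _ _)
            (subst (λ t → IsTraceOf t f xs y)
               (sym (trans (traceNode-child _ _ _ _ 0) (nth-cons-zero t 0))) trace))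
  complete {c = prec f g} {suc k ∷ xs} {y} (ev-prec-s {r = r} ev₀ ev₁) with complete ev₀ | complete ev₁
  ... | t₀ , trace₀ | t₁ , trace₁ =
    _ , node-IsTraceOf (prec f g) (suc k ∷ xs) y (cons t₀ (cons t₁ 0))
          (complete-prec-suc _ f g k xs r y (traceNode-positive _ _ _ _)
            (traceNode-codeOf _ _ _ _) (traceNode-argsOf _ _ _ _) (traceNode-outOf _ _ _ _)
            (subst (λ t → IsTraceOf t (prec f g) (k ∷ xs) r)
               (sym (trans (traceNode-child _ _ _ _ 0) (nth-cons-zero t₀ _))) trace₀)
            (subst (λ t → IsTraceOf t g (k ∷ r ∷ xs) y)
               (sym (trans (traceNode-child _ _ _ _ 1)
                      (trans (nth-cons-suc t₀ _ 0) (nth-cons-zero t₁ 0)))) trace₁))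
  complete {c = mu f} {xs} {y} (ev-mu zeroAt-y positiveBelow-y)
    with finiteChoice (suc y) (MuStepTrace f xs y) stepTrace
    where
    stepTrace : ∀ z → z < suc y → Σ ℕ (MuStepTrace f xs y z)
    stepTrace z z<1+y with z <? y
    ... | yes z<y with positiveBelow-y z z<y
    ...   | _ , ev with complete ev
    ...     | t , check , code , args , out =
              t , check , code , args , trans (cong isZero out) (sym (≢⇒eqᵇ≡0 (<⇒≢ z<y)))
    stepTrace z z<1+y | no z≮y with complete zeroAt-y | ≤-antisym (≤-pred z<1+y) (≮⇒≥ z≮y)
    ...   | t , check , code , args , out | refl =
              t , check , code , args , trans (cong isZero out) (sym (eqᵇ-refl z))
  ... | l , steps =
    _ , node-IsTraceOf (mu f) xs y l
          (complete-mu _ f xs y (traceNode-positive _ _ _ _)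
            (traceNode-codeOf _ _ _ _) (traceNode-argsOf _ _ _ _) (traceNode-outOf _ _ _ _)
            (λ z z≤y → subst (MuStepTrace f xs y z) (sym (traceNode-child _ _ _ _ z)) (steps z (s≤s z≤y))))

  completeAll : ∀ {n m} {gs : Vec (Code n) m} {xs ys} → EvalAll gs xs ys →
                Σ ℕ λ l → ∀ j → IsTraceOf (nth l (toℕ j)) (lookup gs j) xs (lookup ys j)
  completeAll [] = 0 , λ ()
  completeAll {gs = g ∷ gs} {xs} {y ∷ ys} (ev ∷ evs) with complete ev | completeAll evs
  ... | t , trace | l , traces = cons t l , λ
    { fzero → subst (λ t → IsTraceOf t g xs y) (sym (nth-cons-zero t l)) trace
    ; (fsuc j) → subst (λ t → IsTraceOf t (lookup gs j) xs (lookup ys j))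
                   (sym (nth-cons-suc t l (toℕ j))) (traces j) }

-- Kleene's normal form and unbounded search

KleeneT : (e x s : ℕ) → ℕ
KleeneT e x s = allOne (checkTrace s ∷ eqᵇ (codeOf s) e ∷ eqᵇ (hd (argsOf s)) x ∷ [])

KleeneTᶜ : Computable 3 (ternary KleeneT)
KleeneTᶜ = Computable-resp (λ { (_ ∷ _ ∷ _ ∷ []) → refl }) (allOneᶜ
  ( comp₁ checkTraceᶜ π₂
  ∷ comp₂ eqᵇᶜ (comp₁ codeOfᶜ π₂) π₀
  ∷ comp₂ eqᵇᶜ (comp₁ hdᶜ (comp₁ argsOfᶜ π₂)) π₁
  ∷ []))

KleeneT-sound : ∀ (c : Code 1) x s → KleeneT ⌜ c ⌝ x s ≡ 1 → Eval c (x ∷ []) (outOf s)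
KleeneT-sound c x s T≡1
  with allOne≡1⇒All (checkTrace s ∷ eqᵇ (codeOf s) ⌜ c ⌝ ∷ eqᵇ (hd (argsOf s)) x ∷ []) T≡1
... | check ∷ code ∷ input ∷ [] =
  checkTrace-sound s check c (x ∷ []) (eqᵇ≡1⇒≡ code)
    λ { fzero → trans (nth-zero (argsOf s)) (eqᵇ≡1⇒≡ input) }

KleeneT-complete : ∀ (c : Code 1) x {y} → Eval c (x ∷ []) y →
                   Σ ℕ λ s → KleeneT ⌜ c ⌝ x s ≡ 1 × outOf s ≡ y
KleeneT-complete c x ev with complete ev
... | s , check , code , args , out =
  s , All⇒allOne≡1 (checkTrace s ∷ eqᵇ (codeOf s) ⌜ c ⌝ ∷ eqᵇ (hd (argsOf s)) x ∷ [])
        (check ∷ ≡⇒eqᵇ≡1 code ∷ ≡⇒eqᵇ≡1 (trans (cong hd args) (hd-cons x 0)) ∷ []) , out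

leastZeroBelow : (F : ℕ → ℕ) → ∀ k →
  (Σ ℕ λ y → F y ≡ 0 × (∀ z → z < y → F z ≢ 0)) ⊎ (∀ z → z < k → F z ≢ 0)
leastZeroBelow F zero = inj₂ (λ _ ())
leastZeroBelow F (suc k) with leastZeroBelow F k
... | inj₁ least = inj₁ least
... | inj₂ noneBelow with F k in Fk
...   | zero = inj₁ (k , Fk , noneBelow)
...   | suc _ = inj₂ λ z z<1+k → case (m≤n⇒m<n∨m≡n (≤-pred z<1+k))
  where
  case : ∀ {z} → z < k ⊎ z ≡ k → F z ≢ 0
  case (inj₁ z<k) = noneBelow _ z<k
  case (inj₂ refl) Fz≡0 = 0≢1+n (trans (sym Fz≡0) Fk)

search : ∀ {n} {P : Fn (suc n)} → Computable (suc n) P → Code n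
search cP = mu (proj₁ (comp₂ distᶜ cP (constᶜ 1)))

search-halts : ∀ {n} {P : Fn (suc n)} (cP : Computable (suc n) P) xs w → P (w ∷ xs) ≡ 1 →
               Σ ℕ λ y → Eval (search cP) xs y × P (y ∷ xs) ≡ 1
search-halts {P = P} cP xs w Pw≡1
  with leastZeroBelow (λ z → ∣ P (z ∷ xs) - 1 ∣) (suc w)
... | inj₂ noneBelow = ⊥-elim (noneBelow w ≤-refl (m≡n⇒∣m-n∣≡0 Pw≡1))
... | inj₁ (y , atY , belowY) =
  y , ev-mu (subst (Eval D (y ∷ xs)) atY (evD (y ∷ xs)))
            (λ z z<y → pred ∣ P (z ∷ xs) - 1 ∣ ,
               subst (Eval D (z ∷ xs)) (sym (suc-pred _ {{≢-nonZero (belowY z z<y)}})) (evD (z ∷ xs)))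
    , ∣m-n∣≡0⇒m≡n atY
  where
  D : Code (suc _)
  D = proj₁ (comp₂ distᶜ cP (constᶜ 1))
  evD : ∀ zs → Eval D zs ∣ P zs - 1 ∣
  evD = proj₂ (comp₂ distᶜ cP (constᶜ 1))

search-finds : ∀ {n} {P : Fn (suc n)} (cP : Computable (suc n) P) xs {y} →
               Eval (search cP) xs y → P (y ∷ xs) ≡ 1
search-finds cP xs {y} (ev-mu atY _) =
  ∣m-n∣≡0⇒m≡n (Eval-deterministic (proj₂ (comp₂ distᶜ cP (constᶜ 1)) (y ∷ xs)) atY)

-- Words, compression and decidability

nextWord : Word → Word
nextWord [] = false ∷ []
nextWord (false ∷ w) = true ∷ w
nextWord (true ∷ w) = false ∷ nextWord w

enc-nextWord : ∀ w → enc (nextWord w) ≡ suc (enc w)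
enc-nextWord [] = refl
enc-nextWord (false ∷ w) = refl
enc-nextWord (true ∷ w) rewrite enc-nextWord w | *-suc 2 (enc w) = refl

decode : ℕ → Word
decode zero = []
decode (suc n) = nextWord (decode n)

enc-decode : ∀ n → enc (decode n) ≡ n
enc-decode zero = refl
enc-decode (suc n) = trans (enc-nextWord (decode n)) (cong suc (enc-decode n))

enc-injective : ∀ w w′ → enc w ≡ enc w′ → w ≡ w′
enc-injective [] [] _ = refl
enc-injective [] (false ∷ _) ()
enc-injective [] (true ∷ _) ()
enc-injective (false ∷ _) [] ()
enc-injective (true ∷ _) [] ()
enc-injective (false ∷ w) (false ∷ w′) eq =
  cong (false ∷_) (enc-injective w w′ (*-cancelˡ-≡ _ _ 2 (suc-injective eq)))
enc-injective (true ∷ w) (true ∷ w′) eq =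
  cong (true ∷_) (enc-injective w w′ (*-cancelˡ-≡ _ _ 2 (suc-injective (suc-injective eq))))
enc-injective (false ∷ w) (true ∷ w′) eq = ⊥-elim (even≢odd (enc w) (enc w′) (suc-injective eq))
enc-injective (true ∷ w) (false ∷ w′) eq = ⊥-elim (even≢odd (enc w′) (enc w) (suc-injective (sym eq)))

decode-enc : ∀ w → decode (enc w) ≡ w
decode-enc w = enc-injective _ _ (enc-decode (enc w))

onCodes : (Word → Word) → ℕ → ℕ
onCodes f n = enc (f (decode n))

onCodesᶜ : ∀ {f} → IsTotalRecursive f → Computable 1 (unary (onCodes f))
onCodesᶜ {f} (c , ev) = c , λ { (n ∷ []) →
  subst (λ m → Eval c (m ∷ []) (onCodes f n)) (enc-decode n) (ev (decode n)) }

module CompressionDecider {A : Language} (re : IsRE A) {f : Word → Word}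
                          (total : IsTotalRecursive f) (compress : IsCompressionFunction A f) where

  private
    e : ℕ
    e = ⌜ proj₁ re ⌝
    F : ℕ → ℕ
    F = onCodes f

  -- Witness s (enc w) = 1 when s = pair x t, t a halting trace of A's semi-decider on x,
  -- and f x = f w.
  Witness : ℕ → ℕ → ℕ
  Witness s n = allOne (KleeneT e (unpair₁ s) (unpair₂ s) ∷ eqᵇ (F (unpair₁ s)) (F n) ∷ [])

  Witnessᶜ : Computable 2 (binary Witness)
  Witnessᶜ = Computable-resp (λ { (_ ∷ _ ∷ []) → refl }) (allOneᶜ
    ( comp₃ KleeneTᶜ (constᶜ e) (comp₁ unpair₁ᶜ π₀) (comp₁ unpair₂ᶜ π₀)
    ∷ comp₂ eqᵇᶜ (comp₁ (onCodesᶜ total) (comp₁ unpair₁ᶜ π₀)) (comp₁ (onCodesᶜ total) π₁)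
    ∷ []))

  witness-exists : ∀ w → Σ ℕ λ s → Witness s (enc w) ≡ 1
  witness-exists w with proj₁ compress (f w)
  ... | x , Ax , fx≡fw with KleeneT-complete (proj₁ re) (enc x) (proj₂ (Equivalence.to (proj₂ re x) Ax))
  ...   | t , trace , _ =
    pair (enc x) t , All⇒allOne≡1 (KleeneT e (unpair₁ (pair (enc x) t)) (unpair₂ (pair (enc x) t)) ∷
                                   eqᵇ (F (unpair₁ (pair (enc x) t))) (F (enc w)) ∷ [])
      ( subst₂ (λ x t → KleeneT e x t ≡ 1) (sym (unpair₁-pair _ t)) (sym (unpair₂-pair _ t)) trace
      ∷ ≡⇒eqᵇ≡1 (trans (cong F (unpair₁-pair (enc x) t))
                        (cong enc (trans (cong f (decode-enc x)) (trans fx≡fw (cong f (sym (decode-enc w)))))))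
      ∷ [])

  witness-sound : ∀ s w → Witness s (enc w) ≡ 1 →
                  A (decode (unpair₁ s)) × f (decode (unpair₁ s)) ≡ f w
  witness-sound s w W≡1
    with allOne≡1⇒All (KleeneT e (unpair₁ s) (unpair₂ s) ∷ eqᵇ (F (unpair₁ s)) (F (enc w)) ∷ []) W≡1
  ... | trace ∷ sameImage ∷ [] =
      Equivalence.from (proj₂ re _)
        (outOf (unpair₂ s) , subst (λ x → Eval (proj₁ re) (x ∷ []) (outOf (unpair₂ s)))
                               (sym (enc-decode (unpair₁ s)))
               (KleeneT-sound (proj₁ re) (unpair₁ s) (unpair₂ s) trace))
    , enc-injective _ _ (trans (eqᵇ≡1⇒≡ sameImage) (cong (λ w → enc (f w)) (decode-enc w)))

  decider : Code 1
  decider = comp (proj₁ eqᵇᶜ) (comp (proj₁ unpair₁ᶜ) (search Witnessᶜ ∷ []) ∷ proj fzero ∷ [])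

  decider-output : ∀ n s → Eval (search Witnessᶜ) (n ∷ []) s → Eval decider (n ∷ []) (eqᵇ (unpair₁ s) n)
  decider-output n s ev =
    ev-comp {ys = unpair₁ s ∷ n ∷ []}
      (ev-comp {ys = s ∷ []} (ev ∷ []) (proj₂ unpair₁ᶜ (s ∷ [])) ∷ ev-proj ∷ [])
      (proj₂ eqᵇᶜ (unpair₁ s ∷ n ∷ []))

  decider-eval : ∀ w → Σ ℕ λ s → Eval decider (enc w ∷ []) (eqᵇ (unpair₁ s) (enc w)) ×
                                 A (decode (unpair₁ s)) × f (decode (unpair₁ s)) ≡ f w
  decider-eval w = conclude (search-halts Witnessᶜ (enc w ∷ []) _ (proj₂ (witness-exists w)))
    where
    conclude : (Σ ℕ λ s → Eval (search Witnessᶜ) (enc w ∷ []) s × Witness s (enc w) ≡ 1) →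
               Σ ℕ λ s → Eval decider (enc w ∷ []) (eqᵇ (unpair₁ s) (enc w)) ×
                         A (decode (unpair₁ s)) × f (decode (unpair₁ s)) ≡ f w
    conclude (s₀ , ev , found₀) = s₀ , decider-output (enc w) s₀ ev , witness-sound s₀ w found₀

  isREC : IsREC A
  isREC = decider , λ w → accept w , reject w
    where
    accept : ∀ w → A w → Eval decider (enc w ∷ []) 1
    accept w Aw =
      let s , ev , As , fs≡fw = decider-eval w
      in subst (Eval decider (enc w ∷ []))
           (≡⇒eqᵇ≡1 (trans (sym (enc-decode (unpair₁ s))) (cong enc (proj₂ compress _ w As Aw fs≡fw)))) ev
    reject : ∀ w → ¬ A w → Eval decider (enc w ∷ []) 0
    reject w ¬Aw =
      let s , ev , As , _ = decider-eval w
      in subst (Eval decider (enc w ∷ []))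
           (≢⇒eqᵇ≡0 {unpair₁ s} {enc w} (λ eq → ¬Aw (subst A (trans (cong decode eq) (decode-enc w)) As))) ev

RE∧compressible⇒REC : ∀ {A} → IsRE A → IsFREC-compressible A → IsREC A
RE∧compressible⇒REC re (_ , total , compress) = CompressionDecider.isREC re total compress

K : Language
K w = Σ ℕ λ s → KleeneT (enc w) (enc w) s ≡ 1

K-RE : IsRE K
K-RE = search selfTraceᶜ , λ w → mk⇔
  (λ (s , trace) → let y , ev , _ = search-halts selfTraceᶜ (enc w ∷ []) s trace in y , ev)
  (λ (y , ev) → y , search-finds selfTraceᶜ (enc w ∷ []) ev)
  where
  selfTraceᶜ : Computable 2 (λ { (s ∷ x ∷ []) → KleeneT x x s })
  selfTraceᶜ = Computable-resp (λ { (_ ∷ _ ∷ []) → refl }) (comp₃ KleeneTᶜ π₁ π₁ π₀)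

haltsOnZero : Code 1 → Code 1
haltsOnZero d = mu (comp d (proj (fsuc fzero) ∷ []))

haltsOnZero-halts : ∀ d x → Eval d (x ∷ []) 0 → Eval (haltsOnZero d) (x ∷ []) 0
haltsOnZero-halts d x ev = ev-mu (ev-comp (ev-proj ∷ []) ev) (λ _ ())

haltsOnZero-sound : ∀ d x {y} → Eval (haltsOnZero d) (x ∷ []) y → Eval d (x ∷ []) 0
haltsOnZero-sound d x (ev-mu (ev-comp (ev-proj ∷ []) ev) _) = ev

-- The diagonal word codes the machine that halts exactly where d rejects, so it lies in K
-- iff d rejects it.
¬K-REC : ¬ IsREC K
¬K-REC (d , decides) = diagonal∉K diagonal∈K
  where
  e : ℕ
  e = ⌜ haltsOnZero d ⌝
  diagonal : Word
  diagonal = decode e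
  at-e : ∀ {y} → Eval d (enc diagonal ∷ []) y → Eval d (e ∷ []) y
  at-e = subst (λ x → Eval d (x ∷ []) _) (enc-decode e)
  diagonal∉K : ¬ K diagonal
  diagonal∉K (s , trace) = 0≢1+n (Eval-deterministic
    (haltsOnZero-sound d e (KleeneT-sound (haltsOnZero d) e s
      (subst (λ x → KleeneT x x s ≡ 1) (enc-decode e) trace)))
    (at-e (proj₁ (decides diagonal) (s , trace))))
  diagonal∈K : K diagonal
  diagonal∈K with KleeneT-complete (haltsOnZero d) e
                    (haltsOnZero-halts d e (at-e (proj₂ (decides diagonal) diagonal∉K)))
  ... | s , trace , _ = s , subst (λ x → KleeneT x x s ≡ 1) (sym (enc-decode e)) trace

≤m-REC : ∀ {A B} → B ≤m A → IsREC A → IsREC B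
≤m-REC (g , (cg , evg) , B⇔Ag) (d , decides) = comp d (cg ∷ []) , λ w →
    (λ Bw → ev-comp (evg w ∷ []) (proj₁ (decides (g w)) (Equivalence.to (B⇔Ag w) Bw)))
  , (λ ¬Bw → ev-comp (evg w ∷ []) (proj₂ (decides (g w)) (λ Agw → ¬Bw (Equivalence.from (B⇔Ag w) Agw))))

corollary19 : (∀ (A : Language) → IsRE A → ¬ IsREC A → ¬ IsFREC-compressible A)
              × (∀ (A : Language) → IsRE-complete A → ¬ IsFREC-compressible A)
corollary19 =
    (λ A re ¬rec compressible → ¬rec (RE∧compressible⇒REC re compressible))
  , (λ A (re , hard) compressible → ¬K-REC (≤m-REC (hard K K-RE) (RE∧compressible⇒REC re compressible)))
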